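{- Let $G$ be a graph and $X\subseteq V(G)$ with $|X|\ge 2$. If there is an MWIS-circuit of $G$ with $\tau$ gates, then there are tropical polynomials $g_1,h_1,\dots,g_\tau,h_\tau$ in the variables $V(G)$ such that $g_1\cdot h_1+\dots+g_\tau\cdot h_\tau$ is an MWIS-polynomial of $G$ and for all $i$ it holds that $|\mathrm{Sup}(g_i)\cap X|\le 2|X|/3$ and $|\mathrm{Sup}(h_i)\cap X|\le 2|X|/3$.
   Context: Tropical polynomials are over $(\mathbb{R}\cup\{ -\infty\},\max,+)$ with $\max$ as addition ($+$ in the claim) and $+$ as multiplication ($\cdot$ in the claim); a tropical polynomial with all coefficients $0$ is a set of monomials (finite multisets of variables), sums are unions and products are sets of all pairwise products. $\mathrm{Sup}(f)$ is the set of variables occurring in monomials of $f$. A tropical circuit over variables $X$ is a finite directed acyclic graph whose gates have in-degree $0$ or $2$; in-degree-$0$ gates are labeled by a variable or the constant $0$, in-degree-$2$ gates by $\max$ or $+$, and one gate is the output; each gate computes a tropical polynomial in the natural way (a leaf $x$ gives $\{x\}$, a leaf $0$ the empty monomial). An MWIS-polynomial of $G$ is a tropical polynomial in variables $V(G)$ such that (1) every monomial is $v_1\cdots v_l$ for an independent set $\{v_1,\dots,v_l\}$ of $G$, and (2) for every independent set (including $\emptyset$) the corresponding monomial occurs. An MWIS-circuit of $G$ is a tropical circuit over $V(G)$ computing an MWIS-polynomial of $G$. -}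

module Defs where

open import Data.Nat using (ℕ; zero; suc; _+_; _*_; _≤_)
open import Data.Fin using (Fin)
open import Data.Vec using (Vec; []; _∷_; zipWith; lookup; tabulate; map)
open import Data.List using (List; []; _∷_; _++_; concatMap)
open import Data.Bool.ListAction using (any)
import Data.List as L
open import Data.List.Membership.Propositional using (_∈_)
open import Data.Bool using (Bool; true; false; if_then_else_)
open import Data.Fin.Subset using (Subset; _∩_; ∣_∣) renaming (_∈_ to _∈ₛ_)
open import Data.Product using (Σ; ∃; _×_; _,_)
open import Relation.Binary.PropositionalEquality using (_≡_)
open import Relation.Nullary using (¬_)

record Graph (n : ℕ) : Set₁ where
  field
    Adj     : Fin n → Fin n → Set
    sym     : ∀ {u v} → Adj u v → Adj v u
    irrefl  : ∀ {v} → ¬ Adj v v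

open Graph public

Monomial : ℕ → Set
Monomial n = Vec ℕ n

-- A tropical polynomial with all coefficients 0: a finite set of monomials,
-- represented by a list (only membership matters).
Poly : ℕ → Set
Poly n = List (Monomial n)

_⊕_ : ∀ {n} → Poly n → Poly n → Poly n
f ⊕ g = f ++ g

_⊗_ : ∀ {n} → Poly n → Poly n → Poly n
f ⊗ g = concatMap (λ a → L.map (λ b → zipWith _+_ a b) g) f

-- the constant 0 (empty monomial) and a variable
one : ∀ {n} → Poly n
one {n} = tabulate {n = n} (λ _ → 0) ∷ []

var : ∀ {n} → Fin n → Poly n
var {n} x = tabulate (λ y → isOne y) ∷ []
  where
  open import Data.Fin using (_≟_)
  open import Relation.Nullary using (yes; no)
  isOne : Fin n → ℕ
  isOne y with y ≟ x
  ... | yes _ = 1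
  ... | no _  = 0

positive : ℕ → Bool
positive zero    = false
positive (suc _) = true

Sup : ∀ {n} → Poly n → Subset n
Sup {n} f = tabulate (λ v → any (λ m → positive (lookup m v)) f)

-- Tropical circuits: gates listed in a topological order.
-- A gate added after k earlier gates may only use those k gates as inputs.
data Gate (n k : ℕ) : Set where
  varG  : Fin n → Gate n k
  zeroG : Gate n k
  maxG  : Fin k → Fin k → Gate n k
  plusG : Fin k → Fin k → Gate n k

data Circuit (n : ℕ) : ℕ → Set where
  []  : Circuit n 0
  _▷_ : ∀ {k} → Circuit n k → Gate n k → Circuit n (suc k)

-- polynomials computed at the gates (index zero = most recently added gate)
gateVals : ∀ {n k} → Circuit n k → Vec (Poly n) k
gateVals []      = []
gateVals (c ▷ g) = evalGate g ∷ vs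
  where
  vs = gateVals c
  evalGate : _ → Poly _
  evalGate (varG x)    = var x
  evalGate zeroG       = one
  evalGate (maxG i j)  = lookup vs i ⊕ lookup vs j
  evalGate (plusG i j) = lookup vs i ⊗ lookup vs j

compute : ∀ {n τ} → Circuit n τ → Fin τ → Poly n
compute c o = lookup (gateVals c) o

Independent : ∀ {n} → Graph n → Subset n → Set
Independent G S = ∀ u v → u ∈ₛ S → v ∈ₛ S → ¬ Adj G u v

monomialOf : ∀ {n} → Subset n → Monomial n
monomialOf S = map (λ b → if b then 1 else 0) S

record IsMWISPoly {n} (G : Graph n) (f : Poly n) : Set where
  field
    sound    : ∀ m → m ∈ f → Σ (Subset n) λ S → Independent G S × m ≡ monomialOf S
    complete : ∀ S → Independent G S → monomialOf S ∈ f

IsMWISCircuit : ∀ {n τ} → Graph n → Circuit n τ → Fin τ → Set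
IsMWISCircuit G c o = IsMWISPoly G (compute c o)

sumProd : ∀ {n τ} → (Fin τ → Poly n) → (Fin τ → Poly n) → Poly n
sumProd {τ = zero}  g h = []
sumProd {τ = suc τ} g h = (g Fin.zero ⊗ h Fin.zero) ⊕ sumProd (λ i → g (Fin.suc i)) (λ i → h (Fin.suc i))
  where import Data.Fin as Fin

-- Write μ p for the number of variables of X occurring in a polynomial p, and F for the computed
-- MWIS-polynomial. Every gate p of the circuit contributes the pair: the monomials of p with X-support
-- inside a set Z_p, and the monomials of F outside Sup p on X that complete each of the former to a monomial
-- of F. Given a monomial of F, descend from the output keeping it in the form a + b, with a a monomial of the
-- current gate p and a′ + b ∈ F for every monomial a′ of p; at the output μ = |X|. Stop once μ p ≤ 2|X|/3,
-- with Z_p = Sup p ∩ X: as F is multilinear, b avoids Sup p, so it lives in X minus Sup p, of size at most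
-- 2|X|/3. Otherwise, at a ⊗-gate move to the child with larger μ, so μ stays at least |X|/3; at a ⊕-gate
-- move to the child containing a if its μ is at least |X|/3, and else stop at the ⊕-gate with Z_p the
-- X-support of that child, which is well defined since the two children cannot both be that small.
-- Leaves are never reached, as μ ≤ 1 < 2|X|/3 there.

module Submission where

open import Defs hiding (sym)
open import Data.Bool.Base using (Bool; true; false; T; if_then_else_)
open import Data.Bool.Properties using (T-≡)
open import Data.Fin using (Fin; zero; suc; _≟_)
open import Data.Fin.Subset using (Subset; _∩_; _∪_; _─_; ∣_∣; ⁅_⁆; _⊆_; inside; outside)
  renaming (_∈_ to _∈ₛ_; ⊥ to ∅)
open import Data.Fin.Subset.Properties
  using (x∈p∩q⁺; x∈p∩q⁻; x∈p∪q⁺; x∈p∪q⁻; x∈p∧x∉q⇒x∈p─q; p⊆q⇒∣p∣≤∣q∣; ∣⊥∣≡0; ∣⁅x⁆∣≡1;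
         x∈⁅x⁆; x∈⁅y⁆⇒x≡y; out⊆; in⊆in; _⊆?_)
open import Data.List.Base using ([]; _∷_; _++_; filter; cartesianProductWith)
import Data.List.Base as List
open import Data.List.Membership.Propositional using (_∈_; find; lose)
open import Data.List.Membership.Propositional.Properties
  using (∈-++⁺ˡ; ∈-++⁺ʳ; ∈-++⁻; ∈-filter⁺; ∈-filter⁻; ∈-cartesianProductWith⁺; ∈-cartesianProductWith⁻)
open import Data.List.Relation.Unary.Any using (here; there)
open import Data.List.Relation.Unary.Any.Properties using (any⁺; any⁻)
open import Data.List.Relation.Unary.All as All using (All; all?)
open import Data.Nat.Base using (ℕ; zero; suc; _+_; _*_; _≤_; _<_; z≤n; s≤s)
open import Data.Nat.Properties hiding (_≟_)
import Data.Nat.Properties as ℕₚ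
open import Data.Product.Base using (Σ; ∃; ∃₂; _×_; _,_; proj₁; proj₂)
open import Data.Sum.Base as Sum using (_⊎_; inj₁; inj₂)
open import Data.Vec.Base using (Vec; []; _∷_; zipWith; lookup; tabulate; replicate)
open import Data.Vec.Properties
  using (∷-injectiveˡ; ∷-injectiveʳ; lookup-zipWith; lookup∘tabulate; lookup-map; []=⇒lookup; lookup⇒[]=;
         zipWith-assoc; zipWith-comm; zipWith-identityʳ; ≡-dec)
open import Function.Base using (_∘_; id)
open import Function.Bundles using (Equivalence)
open import Relation.Nullary using (Dec; yes; no; ¬_; contradiction)
open import Relation.Binary.PropositionalEquality using (_≡_; refl; sym; trans; cong; subst)

infixl 6 _+ᵐ_

_+ᵐ_ : ∀ {n} → Monomial n → Monomial n → Monomial n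
_+ᵐ_ = zipWith _+_

+ᵐ-assoc : ∀ {n} (a b c : Monomial n) → a +ᵐ b +ᵐ c ≡ a +ᵐ (b +ᵐ c)
+ᵐ-assoc = zipWith-assoc +-assoc

+ᵐ-comm : ∀ {n} (a b : Monomial n) → a +ᵐ b ≡ b +ᵐ a
+ᵐ-comm = zipWith-comm +-comm

+ᵐ-identityʳ : ∀ {n} (a : Monomial n) → a +ᵐ replicate n 0 ≡ a
+ᵐ-identityʳ = zipWith-identityʳ +-identityʳ

⊗-cartesianProduct : ∀ {n} (f g : Poly n) → f ⊗ g ≡ cartesianProductWith _+ᵐ_ f g
⊗-cartesianProduct []      g = refl
⊗-cartesianProduct (a ∷ f) g = cong (List.map (a +ᵐ_) g ++_) (⊗-cartesianProduct f g)

∈-⊗⁺ : ∀ {n} {f g : Poly n} {a b} → a ∈ f → b ∈ g → a +ᵐ b ∈ f ⊗ g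
∈-⊗⁺ {f = f} {g} a∈f b∈g =
  subst (_ ∈_) (sym (⊗-cartesianProduct f g)) (∈-cartesianProductWith⁺ _+ᵐ_ a∈f b∈g)

∈-⊗⁻ : ∀ {n} (f g : Poly n) {m} → m ∈ f ⊗ g → ∃₂ λ a b → a ∈ f × b ∈ g × m ≡ a +ᵐ b
∈-⊗⁻ f g {m} m∈ = ∈-cartesianProductWith⁻ _+ᵐ_ f g (subst (m ∈_) (⊗-cartesianProduct f g) m∈)

∈-sumProd⁺ : ∀ {n τ} (g h : Fin τ → Poly n) i {m} → m ∈ g i ⊗ h i → m ∈ sumProd g h
∈-sumProd⁺ g h zero    m∈ = ∈-++⁺ˡ m∈
∈-sumProd⁺ g h (suc i) m∈ = ∈-++⁺ʳ (g zero ⊗ h zero) (∈-sumProd⁺ (g ∘ suc) (h ∘ suc) i m∈)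

∈-sumProd⁻ : ∀ {n τ} (g h : Fin τ → Poly n) {m} → m ∈ sumProd g h → ∃ λ i → m ∈ g i ⊗ h i
∈-sumProd⁻ {τ = suc τ} g h m∈ with ∈-++⁻ (g zero ⊗ h zero) m∈
... | inj₁ m∈₀ = zero , m∈₀
... | inj₂ m∈ₛ with i , m∈ᵢ ← ∈-sumProd⁻ (g ∘ suc) (h ∘ suc) m∈ₛ = suc i , m∈ᵢ

Occurs : ∀ {n} → Fin n → Monomial n → Set
Occurs x m = T (positive (lookup m x))

positive-+ : ∀ k l → T (positive (k + l)) → T (positive k) ⊎ T (positive l)
positive-+ (suc k) l p = inj₁ p
positive-+ zero    l p = inj₂ p

Occurs-+ᵐ : ∀ {n} {x : Fin n} a b → Occurs x (a +ᵐ b) → Occurs x a ⊎ Occurs x b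
Occurs-+ᵐ {x = x} a b occ =
  positive-+ (lookup a x) (lookup b x) (subst (T ∘ positive) (lookup-zipWith _+_ x a b) occ)

Occurs-+ᵐ-both : ∀ {n} {x : Fin n} {a b} → Occurs x a → Occurs x b → 2 ≤ lookup (a +ᵐ b) x
Occurs-+ᵐ-both {x = x} {a} {b} occa occb =
  subst (2 ≤_) (sym (lookup-zipWith _+_ x a b)) (+-mono-≤ (positive⇒≥1 occa) (positive⇒≥1 occb))
  where
  positive⇒≥1 : ∀ {k} → T (positive k) → 1 ≤ k
  positive⇒≥1 {suc k} _ = s≤s z≤n

Occurs-var : ∀ {n} {x y : Fin n} {m} → m ∈ var x → Occurs y m → y ≡ x
Occurs-var {x = x} {y} (here refl) occ with y ≟ x | subst (T ∘ positive) (lookup∘tabulate _ y) occ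
... | yes y≡x | _ = y≡x
... | no _    | ()

Occurs-one : ∀ {n} {y : Fin n} {m} → m ∈ one → ¬ Occurs y m
Occurs-one {y = y} (here refl) occ with subst (T ∘ positive) (lookup∘tabulate _ y) occ
... | ()

∈-tabulate⁺ : ∀ {n} {f : Fin n → Bool} {x} → T (f x) → x ∈ₛ tabulate f
∈-tabulate⁺ {f = f} {x} t = lookup⇒[]= x (tabulate f) (trans (lookup∘tabulate f x) (Equivalence.to T-≡ t))

∈-tabulate⁻ : ∀ {n} {f : Fin n → Bool} {x} → x ∈ₛ tabulate f → T (f x)
∈-tabulate⁻ {f = f} {x} x∈ = Equivalence.from T-≡ (trans (sym (lookup∘tabulate f x)) ([]=⇒lookup x∈))

∈-Sup⁺ : ∀ {n} {f : Poly n} {x m} → m ∈ f → Occurs x m → x ∈ₛ Sup f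
∈-Sup⁺ m∈ occ = ∈-tabulate⁺ (any⁺ _ (lose m∈ occ))

∈-Sup⁻ : ∀ {n} {f : Poly n} {x} → x ∈ₛ Sup f → ∃ λ m → m ∈ f × Occurs x m
∈-Sup⁻ {f = f} x∈ = find (any⁻ _ f (∈-tabulate⁻ x∈))

Sup-mono : ∀ {n} {f g : Poly n} → (∀ {m} → m ∈ f → m ∈ g) → Sup f ⊆ Sup g
Sup-mono f⊆g x∈ with m , m∈ , occ ← ∈-Sup⁻ x∈ = ∈-Sup⁺ (f⊆g m∈) occ

Sup-⊕ : ∀ {n} (f g : Poly n) → Sup (f ⊕ g) ⊆ Sup f ∪ Sup g
Sup-⊕ f g x∈ with m , m∈ , occ ← ∈-Sup⁻ x∈ =
  x∈p∪q⁺ (Sum.map (λ m∈f → ∈-Sup⁺ m∈f occ) (λ m∈g → ∈-Sup⁺ m∈g occ) (∈-++⁻ f m∈))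

Sup-⊗ : ∀ {n} (f g : Poly n) → Sup (f ⊗ g) ⊆ Sup f ∪ Sup g
Sup-⊗ f g x∈ with m , m∈ , occ ← ∈-Sup⁻ x∈ with a , b , a∈ , b∈ , refl ← ∈-⊗⁻ f g m∈ =
  x∈p∪q⁺ (Sum.map (∈-Sup⁺ a∈) (∈-Sup⁺ b∈) (Occurs-+ᵐ a b occ))

Sup-var : ∀ {n} (x : Fin n) → Sup (var x) ⊆ ⁅ x ⁆
Sup-var x y∈ with m , m∈ , occ ← ∈-Sup⁻ y∈ = subst (_∈ₛ ⁅ x ⁆) (sym (Occurs-var m∈ occ)) (x∈⁅x⁆ x)

Sup-one : ∀ {n} → Sup {n} one ⊆ ∅
Sup-one y∈ with m , m∈ , occ ← ∈-Sup⁻ y∈ = contradiction occ (Occurs-one m∈)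

Sup-∩-⊆ : ∀ {n} (f : Poly n) {X z} → (∀ {a} → a ∈ f → Sup (a ∷ []) ∩ X ⊆ z) → Sup f ∩ X ⊆ z
Sup-∩-⊆ f {X} each x∈ with x∈f , x∈X ← x∈p∩q⁻ (Sup f) X x∈ with m , m∈ , occ ← ∈-Sup⁻ x∈f =
  each m∈ (x∈p∩q⁺ (∈-Sup⁺ {f = m ∷ []} (here refl) occ , x∈X))

∣p∪q∣≤∣p∣+∣q∣ : ∀ {n} (p q : Subset n) → ∣ p ∪ q ∣ ≤ ∣ p ∣ + ∣ q ∣
∣p∪q∣≤∣p∣+∣q∣ []          []          = z≤n
∣p∪q∣≤∣p∣+∣q∣ (true ∷ p)  (true ∷ q)  = s≤s (≤-trans (∣p∪q∣≤∣p∣+∣q∣ p q) (+-monoʳ-≤ ∣ p ∣ (n≤1+n ∣ q ∣)))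
∣p∪q∣≤∣p∣+∣q∣ (true ∷ p)  (false ∷ q) = s≤s (∣p∪q∣≤∣p∣+∣q∣ p q)
∣p∪q∣≤∣p∣+∣q∣ (false ∷ p) (true ∷ q)  = subst (suc ∣ p ∪ q ∣ ≤_) (sym (+-suc ∣ p ∣ ∣ q ∣)) (s≤s (∣p∪q∣≤∣p∣+∣q∣ p q))
∣p∪q∣≤∣p∣+∣q∣ (false ∷ p) (false ∷ q) = ∣p∪q∣≤∣p∣+∣q∣ p q

∣q∩p∣+∣p─q∣≡∣p∣ : ∀ {n} (p q : Subset n) → ∣ q ∩ p ∣ + ∣ p ─ q ∣ ≡ ∣ p ∣
∣q∩p∣+∣p─q∣≡∣p∣ []          []          = refl
∣q∩p∣+∣p─q∣≡∣p∣ (true ∷ p)  (true ∷ q)  = cong suc (∣q∩p∣+∣p─q∣≡∣p∣ p q)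
∣q∩p∣+∣p─q∣≡∣p∣ (true ∷ p)  (false ∷ q) = trans (+-suc _ _) (cong suc (∣q∩p∣+∣p─q∣≡∣p∣ p q))
∣q∩p∣+∣p─q∣≡∣p∣ (false ∷ p) (true ∷ q)  = ∣q∩p∣+∣p─q∣≡∣p∣ p q
∣q∩p∣+∣p─q∣≡∣p∣ (false ∷ p) (false ∷ q) = ∣q∩p∣+∣p─q∣≡∣p∣ p q

-- In these names, x <⅓ stands for 3 * x < N and x ≤⅔ for 3 * x ≤ 2 * N.
parts<⅓⇒≤⅔ : ∀ {μ x y N} → μ ≤ x + y → 3 * x < N → 3 * y < N → 3 * μ ≤ 2 * N
parts<⅓⇒≤⅔ {μ} {x} {y} {N} μ≤x+y 3x<N 3y<N = begin
  3 * μ         ≤⟨ *-monoʳ-≤ 3 μ≤x+y ⟩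
  3 * (x + y)   ≡⟨ *-distribˡ-+ 3 x y ⟩
  3 * x + 3 * y ≤⟨ +-mono-≤ (<⇒≤ 3x<N) (≤-trans (<⇒≤ 3y<N) (m≤m+n N 0)) ⟩
  2 * N         ∎
  where open ≤-Reasoning

>⅔⇒larger-part≥⅓ : ∀ {μ x y N} → μ ≤ x + y → y ≤ x → 2 * N < 3 * μ → N ≤ 3 * x
>⅔⇒larger-part≥⅓ {x = x} {y} μ≤x+y y≤x 2N<3μ =
  ≮⇒≥ λ 3x<N → <⇒≱ 2N<3μ (parts<⅓⇒≤⅔ {x = x} {y} μ≤x+y 3x<N (≤-<-trans (*-monoʳ-≤ 3 y≤x) 3x<N))

≥⅓⇒rest≤⅔ : ∀ {μ ν N} → μ + ν ≡ N → N ≤ 3 * μ → 3 * ν ≤ 2 * N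
≥⅓⇒rest≤⅔ {μ} {ν} refl μ+ν≤3μ = begin
  ν + 2 * ν     ≤⟨ +-monoˡ-≤ (2 * ν) (+-cancelˡ-≤ μ ν (2 * μ) μ+ν≤3μ) ⟩
  2 * μ + 2 * ν ≡⟨ *-distribˡ-+ 2 μ ν ⟨
  2 * (μ + ν)   ∎
  where open ≤-Reasoning

<⅓⇒≤⅔ : ∀ {x N} → 3 * x < N → 3 * x ≤ 2 * N
<⅓⇒≤⅔ {N = N} 3x<N = ≤-trans (<⇒≤ 3x<N) (m≤m+n N _)

≤1⇒≤⅔ : ∀ {μ N} → μ ≤ 1 → 2 ≤ N → 3 * μ ≤ 2 * N
≤1⇒≤⅔ μ≤1 2≤N = ≤-trans (*-monoʳ-≤ 3 μ≤1) (≤-trans (n≤1+n 3) (*-monoʳ-≤ 2 2≤N))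

lookup-monomialOf≤1 : ∀ {n} (S : Subset n) x → lookup (monomialOf S) x ≤ 1
lookup-monomialOf≤1 (true ∷ S)  zero    = ≤-refl
lookup-monomialOf≤1 (false ∷ S) zero    = z≤n
lookup-monomialOf≤1 (_ ∷ S)     (suc x) = lookup-monomialOf≤1 S x

Occurs-monomialOf : ∀ {n} {S : Subset n} {x} → x ∈ₛ S → Occurs x (monomialOf S)
Occurs-monomialOf {S = S} {x} x∈S rewrite lookup-map x (λ b → if b then 1 else 0) S | []=⇒lookup x∈S = _

monomialOf-summand : ∀ {n} (a b : Monomial n) S → a +ᵐ b ≡ monomialOf S → ∃ λ B → B ⊆ S × b ≡ monomialOf B
monomialOf-summand []      []      []      _  = [] , id , refl
monomialOf-summand (x ∷ a) (y ∷ b) (s ∷ S) eq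
  with B , B⊆S , refl ← monomialOf-summand a b S (∷-injectiveʳ eq) = extend y s (∷-injectiveˡ eq)
  where
  extend : ∀ y s → x + y ≡ (if s then 1 else 0) → ∃ λ B′ → B′ ⊆ s ∷ S × y ∷ monomialOf B ≡ monomialOf B′
  extend zero           s     _ = outside ∷ B , out⊆ B⊆S , refl
  extend (suc zero)     true  _ = inside ∷ B , in⊆in B⊆S , refl
  extend (suc y)        false e = contradiction e (m+1+n≢0 x)
  extend (suc (suc y))  true  e = contradiction (suc-injective (trans (sym (+-suc x (suc y))) e)) (m+1+n≢0 x)

singleton-independent : ∀ {n} (G : Graph n) x → Independent G ⁅ x ⁆
singleton-independent G x u v u∈ v∈ rewrite x∈⁅y⁆⇒x≡y x u∈ | x∈⁅y⁆⇒x≡y x v∈ = irrefl G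

module _ {n} {G : Graph n} {f : Poly n} (mwis : IsMWISPoly G f) where
  open IsMWISPoly mwis

  MWIS-multilinear : ∀ {m} → m ∈ f → ∀ x → lookup m x ≤ 1
  MWIS-multilinear m∈ x with S , _ , refl ← sound _ m∈ = lookup-monomialOf≤1 S x

  MWIS-summand : ∀ {a b} → a +ᵐ b ∈ f → b ∈ f
  MWIS-summand {a} {b} a+b∈
    with S , indS , eq ← sound _ a+b∈
    with B , B⊆S , refl ← monomialOf-summand a b S eq =
    complete B λ u v u∈ v∈ → indS u v (B⊆S u∈) (B⊆S v∈)

  MWIS-Sup : ∀ x → x ∈ₛ Sup f
  MWIS-Sup x = ∈-Sup⁺ (complete ⁅ x ⁆ (singleton-independent G x)) (Occurs-monomialOf (x∈⁅x⁆ x))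

  MWIS-resp : ∀ {g} → (∀ {m} → m ∈ g → m ∈ f) → (∀ {m} → m ∈ f → m ∈ g) → IsMWISPoly G g
  MWIS-resp g⊆f f⊆g = record { sound = λ m → sound m ∘ g⊆f ; complete = λ S → f⊆g ∘ complete S }

module Balanced {n} (X : Subset n) where

  μ : Poly n → ℕ
  μ f = ∣ Sup f ∩ X ∣

  XSupp : Monomial n → Subset n
  XSupp a = Sup (a ∷ []) ∩ X

  Small : Subset n → Set
  Small z = 3 * ∣ z ∣ ≤ 2 * ∣ X ∣

  Small-⊆ : ∀ {s} z → s ⊆ z → Small z → Small s
  Small-⊆ z s⊆z small = ≤-trans (*-monoʳ-≤ 3 (p⊆q⇒∣p∣≤∣q∣ s⊆z)) small

  Small-∅ : Small ∅
  Small-∅ rewrite ∣⊥∣≡0 n = z≤n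

  μ-⊆ : ∀ f {s} → Sup f ⊆ s → μ f ≤ ∣ s ∣
  μ-⊆ f sub = p⊆q⇒∣p∣≤∣q∣ (sub ∘ proj₁ ∘ x∈p∩q⁻ (Sup f) X)

  μ-subadditive : ∀ f g h → Sup f ⊆ Sup g ∪ Sup h → μ f ≤ μ g + μ h
  μ-subadditive f g h sub = ≤-trans (p⊆q⇒∣p∣≤∣q∣ split) (∣p∪q∣≤∣p∣+∣q∣ (Sup g ∩ X) (Sup h ∩ X))
    where
    split : Sup f ∩ X ⊆ (Sup g ∩ X) ∪ (Sup h ∩ X)
    split x∈ with x∈f , x∈X ← x∈p∩q⁻ (Sup f) X x∈ =
      x∈p∪q⁺ (Sum.map (λ x∈g → x∈p∩q⁺ (x∈g , x∈X)) (λ x∈h → x∈p∩q⁺ (x∈h , x∈X)) (x∈p∪q⁻ _ _ (sub x∈f)))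

  μ-⊕ : ∀ f g → μ (f ⊕ g) ≤ μ f + μ g
  μ-⊕ f g = μ-subadditive (f ⊕ g) f g (Sup-⊕ f g)

  μ-⊗ : ∀ f g → μ (f ⊗ g) ≤ μ f + μ g
  μ-⊗ f g = μ-subadditive (f ⊗ g) f g (Sup-⊗ f g)

  μ-var : ∀ x → μ (var x) ≤ 1
  μ-var x = ≤-trans (μ-⊆ (var x) (Sup-var x)) (≤-reflexive (∣⁅x⁆∣≡1 x))

  μ-one : μ one ≤ 1
  μ-one = ≤-trans (μ-⊆ one Sup-one) (≤-trans (≤-reflexive (∣⊥∣≡0 n)) z≤n)

  XSupp-⊆ : ∀ {a f} → a ∈ f → XSupp a ⊆ Sup f ∩ X
  XSupp-⊆ {a} {f} a∈f x∈ with x∈a , x∈X ← x∈p∩q⁻ (Sup (a ∷ [])) X x∈ =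
    x∈p∩q⁺ (Sup-mono {f = a ∷ []} {f} (λ { (here refl) → a∈f ; (there ()) }) x∈a , x∈X)

  -- Empty when z is not small, so that its X-support is small unconditionally.
  restrict : Subset n → Poly n → Poly n
  restrict z f with 3 * ∣ z ∣ ≤? 2 * ∣ X ∣
  ... | yes _ = filter (λ a → XSupp a ⊆? z) f
  ... | no _  = []

  ∈-restrict⁺ : ∀ {z f a} → a ∈ f → XSupp a ⊆ z → Small z → a ∈ restrict z f
  ∈-restrict⁺ {z} a∈f a⊆z small with 3 * ∣ z ∣ ≤? 2 * ∣ X ∣
  ... | yes _    = ∈-filter⁺ (λ a → XSupp a ⊆? z) a∈f a⊆z
  ... | no large = contradiction small large

  ∈-restrict⁻ : ∀ z f {a} → a ∈ restrict z f → a ∈ f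
  ∈-restrict⁻ z f a∈ with 3 * ∣ z ∣ ≤? 2 * ∣ X ∣
  ... | yes _ = proj₁ (∈-filter⁻ (λ a → XSupp a ⊆? z) a∈)

  restrict-small : ∀ z f → Small (Sup (restrict z f) ∩ X)
  restrict-small z f with 3 * ∣ z ∣ ≤? 2 * ∣ X ∣
  ... | yes small = Small-⊆ z (Sup-∩-⊆ _ (proj₂ ∘ ∈-filter⁻ (λ a → XSupp a ⊆? z) {xs = f})) small
  ... | no _      = Small-⊆ ∅ (Sup-∩-⊆ [] λ ()) Small-∅

  leftSetAt : Poly n → Subset n → Subset n
  leftSetAt p fallback with 3 * μ p ≤? 2 * ∣ X ∣
  ... | yes _ = Sup p ∩ X
  ... | no _  = fallback

  smallerChild : Poly n → Poly n → Subset n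
  smallerChild q r with 3 * μ q <? ∣ X ∣
  ... | yes _ = Sup q ∩ X
  ... | no _  = Sup r ∩ X

  -- Only a ⊕-gate is ever stopped at while its X-support exceeds two thirds of X.
  fallback : ∀ {k} → Vec (Poly n) k → Gate n k → Subset n
  fallback vs (maxG i j) = smallerChild (lookup vs i) (lookup vs j)
  fallback vs _          = ∅

  leftSets : ∀ {k} → Circuit n k → Vec (Subset n) k
  leftSets []      = []
  leftSets (c ▷ g) = leftSetAt (lookup (gateVals (c ▷ g)) zero) (fallback (gateVals c) g) ∷ leftSets c

  leftSetAt-small : ∀ {p fallback} → Small (Sup p ∩ X) → leftSetAt p fallback ≡ Sup p ∩ X
  leftSetAt-small {p} small with 3 * μ p ≤? 2 * ∣ X ∣
  ... | yes _    = refl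
  ... | no large = contradiction small large

  leftSetAt-⊕ˡ : ∀ q r → 2 * ∣ X ∣ < 3 * μ (q ⊕ r) → 3 * μ q < ∣ X ∣ →
                 leftSetAt (q ⊕ r) (smallerChild q r) ≡ Sup q ∩ X
  leftSetAt-⊕ˡ q r large smallq with 3 * μ (q ⊕ r) ≤? 2 * ∣ X ∣ | 3 * μ q <? ∣ X ∣
  ... | yes notLarge | _        = contradiction notLarge (<⇒≱ large)
  ... | no _         | yes _    = refl
  ... | no _         | no big   = contradiction smallq big

  leftSetAt-⊕ʳ : ∀ q r → 2 * ∣ X ∣ < 3 * μ (q ⊕ r) → 3 * μ r < ∣ X ∣ →
                 leftSetAt (q ⊕ r) (smallerChild q r) ≡ Sup r ∩ X
  leftSetAt-⊕ʳ q r large smallr with 3 * μ (q ⊕ r) ≤? 2 * ∣ X ∣ | 3 * μ q <? ∣ X ∣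
  ... | yes notLarge | _          = contradiction notLarge (<⇒≱ large)
  ... | no _         | yes smallq =
    contradiction (parts<⅓⇒≤⅔ {x = μ q} {μ r} (μ-⊕ q r) smallq smallr) (<⇒≱ large)
  ... | no _         | no _       = refl

  module Decomposition (2≤∣X∣ : 2 ≤ ∣ X ∣) (F : Poly n)
                       (multilinear : ∀ {m} → m ∈ F → ∀ x → lookup m x ≤ 1)
                       (summand∈F : ∀ {a b} → a +ᵐ b ∈ F → b ∈ F) where

    open import Data.List.Membership.DecPropositional (≡-dec {n = n} ℕₚ._≟_) using (_∈?_)

    compatible? : ∀ (g : Poly n) b → Dec (All (λ a → a +ᵐ b ∈ F) g)
    compatible? g b = all? (λ a → a +ᵐ b ∈? F) g

    left : Poly n → Subset n → Poly n
    left p z = restrict z p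

    right : Poly n → Subset n → Poly n
    right p z = restrict (X ─ Sup p) (filter (compatible? (left p z)) F)

    left⊗right⊆F : ∀ p z {m} → m ∈ left p z ⊗ right p z → m ∈ F
    left⊗right⊆F p z m∈ with a , b , a∈ , b∈ , refl ← ∈-⊗⁻ (left p z) (right p z) m∈ =
      All.lookup (proj₂ (∈-filter⁻ (compatible? (left p z)) {xs = F} b∈candidates)) a∈
      where
      b∈candidates : b ∈ filter (compatible? (left p z)) F
      b∈candidates = ∈-restrict⁻ (X ─ Sup p) (filter (compatible? (left p z)) F) b∈

    Context : Poly n → Monomial n → Set
    Context p b = ∀ {a} → a ∈ p → a +ᵐ b ∈ F

    ∈-left⊗right : ∀ {p} q {z a b} → z ≡ Sup q ∩ X → Small (Sup q ∩ X) → a ∈ q → a ∈ p → Context p b →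
                   ∣ X ∣ ≤ 3 * μ p → a +ᵐ b ∈ left p z ⊗ right p z
    ∈-left⊗right {p} q {b = b} refl small a∈q a∈p ctx big =
      ∈-⊗⁺ (∈-restrict⁺ {Sup q ∩ X} a∈p (XSupp-⊆ a∈q) small) (∈-restrict⁺ {X ─ Sup p} b∈ b⊆X─p rest-small)
      where
      b∈ : b ∈ filter (compatible? (left p (Sup q ∩ X))) F
      b∈ = ∈-filter⁺ (compatible? (left p (Sup q ∩ X))) (summand∈F (ctx a∈p))
                     (All.tabulate (ctx ∘ ∈-restrict⁻ (Sup q ∩ X) p))
      b⊆X─p : XSupp b ⊆ X ─ Sup p
      b⊆X─p {x} x∈
        with x∈b , x∈X ← x∈p∩q⁻ (Sup (b ∷ [])) X x∈
        with _ , here refl , occb ← ∈-Sup⁻ {f = b ∷ []} x∈b =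
        x∈p∧x∉q⇒x∈p─q x∈X λ x∈p → let a′ , a′∈ , occa′ = ∈-Sup⁻ {f = p} x∈p in
          <⇒≱ (Occurs-+ᵐ-both {a = a′} {b} occa′ occb) (multilinear (ctx a′∈) x)
      rest-small : Small (X ─ Sup p)
      rest-small = ≥⅓⇒rest≤⅔ {μ p} (∣q∩p∣+∣p─q∣≡∣p∣ X (Sup p)) big

    gateAt : ∀ {k} → Circuit n k → Fin k → Poly n
    gateAt c u = lookup (gateVals c) u

    leftAt rightAt : ∀ {k} → Circuit n k → Fin k → Poly n
    leftAt  c u = left  (gateAt c u) (lookup (leftSets c) u)
    rightAt c u = right (gateAt c u) (lookup (leftSets c) u)

    leftAt-small : ∀ {k} (c : Circuit n k) u → Small (Sup (leftAt c u) ∩ X)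
    leftAt-small c u = restrict-small (lookup (leftSets c) u) (gateAt c u)

    rightAt-small : ∀ {k} (c : Circuit n k) u → Small (Sup (rightAt c u) ∩ X)
    rightAt-small c u = restrict-small (X ─ Sup (gateAt c u)) _

    record Found {k} (c : Circuit n k) (m : Monomial n) : Set where
      constructor found
      field
        gate    : Fin k
        product : m ∈ leftAt c gate ⊗ rightAt c gate

    Found-▷ : ∀ {k} {c : Circuit n k} {g m} → Found c m → Found (c ▷ g) m
    Found-▷ (found j m∈) = found (suc j) m∈

    descend : ∀ {k} (c : Circuit n k) u {a b} → a ∈ gateAt c u → Context (gateAt c u) b →
              ∣ X ∣ ≤ 3 * μ (gateAt c u) → Found c (a +ᵐ b)
    descendLarge : ∀ {k} (c : Circuit n k) g {a b} →
                   a ∈ gateAt (c ▷ g) zero → Context (gateAt (c ▷ g) zero) b →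
                   ∣ X ∣ ≤ 3 * μ (gateAt (c ▷ g) zero) → 2 * ∣ X ∣ < 3 * μ (gateAt (c ▷ g) zero) →
                   Found (c ▷ g) (a +ᵐ b)
    descendFactor : ∀ {k} (c : Circuit n k) g v {a a′ b} → a ∈ gateAt c v →
                    (∀ {x} → x ∈ gateAt c v → x +ᵐ a′ ∈ gateAt (c ▷ g) zero) →
                    Context (gateAt (c ▷ g) zero) b → ∣ X ∣ ≤ 3 * μ (gateAt c v) →
                    Found (c ▷ g) (a +ᵐ a′ +ᵐ b)

    descend (c ▷ g) (suc u) a∈ ctx big = Found-▷ (descend c u a∈ ctx big)
    descend (c ▷ g) zero    a∈ ctx big with 3 * μ (gateAt (c ▷ g) zero) ≤? 2 * ∣ X ∣
    ... | yes small =
      found zero (∈-left⊗right (gateAt (c ▷ g) zero) (leftSetAt-small small) small a∈ a∈ ctx big)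
    ... | no large  = descendLarge c g a∈ ctx big (≰⇒> large)

    descendLarge c (varG x) _ _ _ large = contradiction (≤1⇒≤⅔ (μ-var x) 2≤∣X∣) (<⇒≱ large)
    descendLarge c zeroG    _ _ _ large = contradiction (≤1⇒≤⅔ μ-one 2≤∣X∣) (<⇒≱ large)
    descendLarge c (maxG i j) a∈ ctx big large with ∈-++⁻ (gateAt c i) a∈
    ... | inj₁ a∈ᵢ with 3 * μ (gateAt c i) <? ∣ X ∣
    ...   | yes smallᵢ =
      found zero (∈-left⊗right (gateAt c i) (leftSetAt-⊕ˡ (gateAt c i) (gateAt c j) large smallᵢ)
                               (<⅓⇒≤⅔ {μ (gateAt c i)} smallᵢ) a∈ᵢ a∈ ctx big)
    ...   | no bigᵢ    = Found-▷ (descend c i a∈ᵢ (ctx ∘ ∈-++⁺ˡ) (≮⇒≥ bigᵢ))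
    descendLarge c (maxG i j) a∈ ctx big large | inj₂ a∈ⱼ with 3 * μ (gateAt c j) <? ∣ X ∣
    ...   | yes smallⱼ =
      found zero (∈-left⊗right (gateAt c j) (leftSetAt-⊕ʳ (gateAt c i) (gateAt c j) large smallⱼ)
                               (<⅓⇒≤⅔ {μ (gateAt c j)} smallⱼ) a∈ⱼ a∈ ctx big)
    ...   | no bigⱼ    = Found-▷ (descend c j a∈ⱼ (ctx ∘ ∈-++⁺ʳ (gateAt c i)) (≮⇒≥ bigⱼ))
    descendLarge c (plusG i j) a∈ ctx _ large with ∈-⊗⁻ (gateAt c i) (gateAt c j) a∈
    ... | a₁ , a₂ , a₁∈ , a₂∈ , refl with μ (gateAt c j) ≤? μ (gateAt c i)
    ...   | yes μⱼ≤μᵢ = descendFactor c (plusG i j) i a₁∈ (λ x∈ → ∈-⊗⁺ x∈ a₂∈) ctx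
                          (>⅔⇒larger-part≥⅓ {x = μ (gateAt c i)} (μ-⊗ (gateAt c i) (gateAt c j)) μⱼ≤μᵢ large)
    ...   | no μⱼ≰μᵢ  = subst (Found _) (cong (_+ᵐ _) (+ᵐ-comm a₂ a₁))
                          (descendFactor c (plusG i j) j a₂∈ extend ctx
                            (>⅔⇒larger-part≥⅓ {x = μ (gateAt c j)} μ≤μⱼ+μᵢ (<⇒≤ (≰⇒> μⱼ≰μᵢ)) large))
      where
      extend : ∀ {x} → x ∈ gateAt c j → x +ᵐ a₁ ∈ gateAt c i ⊗ gateAt c j
      extend x∈ = subst (_∈ _) (+ᵐ-comm a₁ _) (∈-⊗⁺ a₁∈ x∈)
      μ≤μⱼ+μᵢ : μ (gateAt c i ⊗ gateAt c j) ≤ μ (gateAt c j) + μ (gateAt c i)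
      μ≤μⱼ+μᵢ = subst (μ (gateAt c i ⊗ gateAt c j) ≤_) (+-comm (μ (gateAt c i)) _) (μ-⊗ (gateAt c i) (gateAt c j))

    descendFactor c g v a∈ extend ctx big =
      subst (Found _) (sym (+ᵐ-assoc _ _ _))
        (Found-▷ (descend c v a∈ (λ x∈ → subst (_∈ F) (+ᵐ-assoc _ _ _) (ctx (extend x∈))) big))

    covers : ∀ {k} (c : Circuit n k) u → (∀ {a} → a ∈ gateAt c u → a ∈ F) → ∣ X ∣ ≤ 3 * μ (gateAt c u) →
             ∀ {m} → m ∈ gateAt c u → m ∈ sumProd (leftAt c) (rightAt c)
    covers c u u⊆F big {m} m∈
      with found j m∈ⱼ ← descend c u m∈ (λ a∈ → subst (_∈ F) (sym (+ᵐ-identityʳ _)) (u⊆F a∈)) big =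
      ∈-sumProd⁺ (leftAt c) (rightAt c) j (subst (_∈ _) (+ᵐ-identityʳ m) m∈ⱼ)

    sumProd⊆F : ∀ {k} (c : Circuit n k) {m} → m ∈ sumProd (leftAt c) (rightAt c) → m ∈ F
    sumProd⊆F c m∈ with j , m∈ⱼ ← ∈-sumProd⁻ (leftAt c) (rightAt c) m∈ =
      left⊗right⊆F (gateAt c j) (lookup (leftSets c) j) m∈ⱼ

lemma15 : ∀ {n} (G : Graph n) (X : Subset n) → 2 ≤ ∣ X ∣ →
    ∀ {τ} (C : Circuit n τ) (o : Fin τ) → IsMWISCircuit G C o →
    Σ (Fin τ → Poly n) λ g → Σ (Fin τ → Poly n) λ h →
      IsMWISPoly G (sumProd g h) ×
      (∀ i → (3 * ∣ Sup (g i) ∩ X ∣ ≤ 2 * ∣ X ∣) × (3 * ∣ Sup (h i) ∩ X ∣ ≤ 2 * ∣ X ∣))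
lemma15 G X 2≤∣X∣ C o mwis =
  leftAt C , rightAt C , MWIS-resp mwis (sumProd⊆F C) (covers C o id X-covered) ,
  λ i → leftAt-small C i , rightAt-small C i
  where
  open Balanced X
  open Decomposition 2≤∣X∣ (compute C o) (MWIS-multilinear mwis) (MWIS-summand mwis)

  X-covered : ∣ X ∣ ≤ 3 * μ (compute C o)
  X-covered = ≤-trans (p⊆q⇒∣p∣≤∣q∣ (λ x∈X → x∈p∩q⁺ (MWIS-Sup mwis _ , x∈X))) (m≤m+n _ _)
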